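{- Let $B=B'(p)$, $\beta_1$, $S_1$ and $B_1=B'(p|S_1)$ be as in the context. For a decreasingly minimal element $m_1$ of $B_1\cap\mathbb{Z}^{S_1}$ let $L_1(m_1):=\{s\in S_1:m_1(s)=\beta_1\}$. Then the set-system $$\mathcal{B}_1:=\{L\subseteq S_1: L=L_1(m_1)\text{ for some decreasingly minimal element }m_1\text{ of }B_1\cap\mathbb{Z}^{S_1}\}$$ forms the set of bases of a matroid $M_1$ on ground-set $S_1$.
   Context: $S$ is a finite non-empty set; $p$ is a set-function on subsets of $S$ with values in $\mathbb{Z}\cup\{ -\infty\}$, $p(\emptyset)=0$, $p(S)$ finite, and supermodular: $p(X)+p(Y)\le p(X\cap Y)+p(X\cup Y)$ whenever $p(X),p(Y)$ are finite. For a ground set $U$ and such a function $q$ on $U$, $B'(q)=\{x\in\mathbb{R}^U:\widetilde x(U)=q(U),\ \widetilde x(Z)\ge q(Z)\ \forall Z\subset U\}$ with $\widetilde x(Z)=\sum_{s\in Z}x(s)$. $\beta_1:=\min\{\max_{s\in S}z(s):z\in B\cap\mathbb{Z}^S\}$; $h_1(X):=p(X)-(\beta_1-1)|X|$ for $X\subseteq S$; the peak-set $S_1$ is the intersection of all maximizers of $h_1$; $p|S_1$ is the restriction of $p$ to subsets of $S_1$. With $x{\downarrow}$ the decreasing rearrangement, $m_1$ is decreasingly minimal in $Q$ if for every $y\in Q$, $m_1{\downarrow}=y{\downarrow}$ or $m_1{\downarrow}(j)<y{\downarrow}(j)$ at the first differing index $j$. -}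

module Defs where

open import Data.Nat using (ℕ)
open import Data.Integer as ℤ using (ℤ; _+_; _-_; _*_; _≤_; _<_; +_; 0ℤ; 1ℤ)
import Data.Integer.Properties as ℤP
open import Data.Maybe using (Maybe; just; nothing)
open import Data.Bool using (Bool; true; false; if_then_else_)
import Data.Bool as Bool
open import Data.Fin using (Fin)
open import Data.Fin.Subset using (Subset; _∈_; _∉_; _⊆_; _⊂_; _∩_; _∪_; ⁅_⁆; ∣_∣)
import Data.Fin.Subset as Sub
open import Data.Vec using (lookup)
open import Data.List using (List; []; _∷_; map; filter; foldr; allFin)
open import Data.Product using (Σ; ∃; ∃-syntax; _×_; _,_)
open import Data.Sum using (_⊎_)
open import Data.Unit using (⊤)
open import Data.Empty using (⊥)
open import Relation.Binary.PropositionalEquality using (_≡_)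
open import Relation.Nullary using (¬_)
import Relation.Binary.Properties.DecTotalOrder as DTO
import Data.List.Sort as Sort

-- ℤ ∪ {-∞}: nothing encodes -∞
ℤ∞ : Set
ℤ∞ = Maybe ℤ

SetFn : ℕ → Set
SetFn n = Subset n → ℤ∞

tsum : {n : ℕ} → (Fin n → ℤ) → Subset n → ℤ
tsum {n} x Z = foldr (λ s acc → (if lookup Z s then x s else 0ℤ) + acc) 0ℤ (allFin n)

Supermodular : {n : ℕ} → SetFn n → Set
Supermodular {n} p = ∀ (X Y : Subset n) (a b : ℤ) → p X ≡ just a → p Y ≡ just b →
  Σ ℤ λ c → Σ ℤ λ d → p (X ∩ Y) ≡ just c × p (X ∪ Y) ≡ just d × a + b ≤ c + d

record IsAdmissible {n : ℕ} (p : SetFn n) : Set where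
  field
    empty-zero   : p Sub.⊥ ≡ just 0ℤ
    full-finite  : ∃[ a ] p Sub.⊤ ≡ just a
    supermodular : Supermodular p

_≥∞_ : ℤ → ℤ∞ → Set
v ≥∞ nothing = ⊤
v ≥∞ just a  = a ≤ v

_≡∞_ : ℤ → ℤ∞ → Set
v ≡∞ nothing = ⊥
v ≡∞ just a  = v ≡ a

-- Integral elements of B'(q) where the ground set is U ⊆ Fin n and q is
-- the restriction of p to subsets of U (only the values of x on U matter).
InB' : {n : ℕ} → (U : Subset n) → SetFn n → (Fin n → ℤ) → Set
InB' U q x = (tsum x U ≡∞ q U) × (∀ Z → Z ⊂ U → tsum x Z ≥∞ q Z)

IsMaxValue : {n : ℕ} → (Fin n → ℤ) → ℤ → Set
IsMaxValue z β = (∃[ s ] z s ≡ β) × (∀ s → z s ≤ β)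

IsBeta1 : {n : ℕ} → SetFn n → ℤ → Set
IsBeta1 p β = (∃[ z ] InB' Sub.⊤ p z × IsMaxValue z β)
            × (∀ z → InB' Sub.⊤ p z → ∀ μ → IsMaxValue z μ → β ≤ μ)

h1 : {n : ℕ} → SetFn n → ℤ → SetFn n
h1 p β X with p X
... | nothing = nothing
... | just a  = just (a - (β - 1ℤ) * + ∣ X ∣)

IsMaximizer : {n : ℕ} → SetFn n → Subset n → Set
IsMaximizer h X = Σ ℤ λ v → h X ≡ just v × (∀ Y c → h Y ≡ just c → c ≤ v)

IsPeakSet : {n : ℕ} → SetFn n → ℤ → Subset n → Set
IsPeakSet p β S₁ = ∀ s → (s ∈ S₁ → ∀ X → IsMaximizer (h1 p β) X → s ∈ X)
                       × ((∀ X → IsMaximizer (h1 p β) X → s ∈ X) → s ∈ S₁)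

open Sort (DTO.≥-decTotalOrder ℤP.≤-decTotalOrder) using (sort)

decRearr : {n : ℕ} → Subset n → (Fin n → ℤ) → List ℤ
decRearr {n} U x = sort (map x (filter (λ s → lookup U s Bool.≟ true) (allFin n)))

DecLeq : List ℤ → List ℤ → Set
DecLeq []       []       = ⊤
DecLeq []       (_ ∷ _)  = ⊥
DecLeq (_ ∷ _)  []       = ⊥
DecLeq (a ∷ as) (b ∷ bs) = (a < b) ⊎ (a ≡ b × DecLeq as bs)

IsDecMin : {n : ℕ} → Subset n → SetFn n → (Fin n → ℤ) → Set
IsDecMin U p m = InB' U p m × (∀ y → InB' U p y → DecLeq (decRearr U m) (decRearr U y))

IsMatroidBases : {n : ℕ} → Subset n → (Subset n → Set) → Set
IsMatroidBases {n} E 𝓑 =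
    (∀ B → 𝓑 B → B ⊆ E)
  × (∃[ B ] 𝓑 B)
  × (∀ B B′ → 𝓑 B → 𝓑 B′ → ∀ x → x ∈ B → x ∉ B′ →
       ∃[ y ] (y ∈ B′ × y ∉ B × 𝓑 ((B Sub.- x) ∪ ⁅ y ⁆)))

IsL1 : {n : ℕ} → Subset n → ℤ → (Fin n → ℤ) → Subset n → Set
IsL1 S₁ β m L = ∀ s → (s ∈ L → s ∈ S₁ × m s ≡ β) × (s ∈ S₁ × m s ≡ β → s ∈ L)

Bases1 : {n : ℕ} → SetFn n → ℤ → Subset n → Subset n → Set
Bases1 p β S₁ L = L ⊆ S₁ × (∃[ m ] IsDecMin S₁ p m × IsL1 S₁ β m L)

-- An integral base of p|S₁ whose values on S₁ all lie in {β₁ - 1, β₁} is decreasingly minimal, as any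
-- two bases have the same number of entries and the same sum; conversely a decreasingly minimal
-- element has the same sorted values as such a base. One exists: lower an integral base of p with
-- values at most β₁ (the only use of the definition of β₁) until S₁ is tight, then repeatedly move a
-- unit from a β₁-entry to an entry below β₁ - 1. This is possible because S₁ maximizes h₁: the
-- maximizers of the supermodular h₁ are closed under intersection, so S₁ is the least of them.
-- For the exchange axiom let m(x) = β₁ ≠ m′(x). The smallest m-tight set containing x contains some
-- t with m(t) = β₁ - 1 and m′(t) = β₁, since otherwise m′ would fall below m, and so below p, on it;
-- moving one unit of m from x to t yields a decreasingly minimal element with L₁ = L₁(m) - x + t.

module Submission where

open import Defs
open import Level using (0ℓ)
open import Function using (_∘_; _∘′_; id)
open import Algebra.Bundles using (AbelianGroup)
open import Data.Nat as ℕ using (ℕ; zero; suc; _≥_)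
import Data.Nat.Properties as ℕP
open import Data.Nat.Induction using (<-wellFounded)
open import Data.Integer as ℤ using (ℤ; _+_; _-_; _*_; _≤_; _<_; +_; -_; 0ℤ; 1ℤ; -1ℤ)
import Data.Integer.Properties as ℤP
open import Data.Integer.Solver using (module +-*-Solver)
open import Data.Bool using (true; false; if_then_else_; _∧_; _∨_)
import Data.Bool as Bool
open import Data.Fin using (Fin; zero; suc)
import Data.Fin.Properties as FinP
open import Data.Fin.Subset using (Subset; _∈_; _∉_; _⊆_; _⊂_; _∩_; _∪_; ⁅_⁆; ∣_∣; ⋃)
import Data.Fin.Subset as Sub
import Data.Fin.Subset.Properties as SubP
open import Data.Vec using ([]; _∷_; lookup)
import Data.Vec as Vec
import Data.Vec.Properties as VecP
open import Data.Maybe using (just; nothing)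
import Data.Maybe.Properties as MaybeP
open import Data.List using (List; []; _∷_; foldr; map; filter; tabulate; allFin; length; _++_)
import Data.List.Properties as ListP
open import Data.List.Relation.Unary.All as All using (All; []; _∷_)
import Data.List.Relation.Unary.All.Properties as AllP
open import Data.List.Relation.Unary.Any using (here; there)
open import Data.List.Relation.Unary.Linked as Linked using (Linked; []; [-]; _∷_)
open import Data.List.Relation.Unary.Linked.Properties using (Linked⇒All)
open import Data.List.Membership.Propositional using () renaming (_∈_ to _∈ₗ_)
import Data.List.Membership.Propositional.Properties as MemP
open import Data.List.Relation.Binary.Permutation.Propositional using (_↭_; ↭-sym; ↭⇒↭ₛ)
import Data.List.Relation.Binary.Permutation.Propositional.Properties as PermP
import Data.List.Relation.Binary.Permutation.Setoid.Properties as PermₛP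
open import Data.Product using (∃; ∃-syntax; _×_; _,_; proj₁; proj₂)
open import Data.Sum using (_⊎_; inj₁; inj₂; [_,_]′)
open import Data.Unit using (tt)
open import Induction.WellFounded using (Acc; acc)
open import Relation.Binary.PropositionalEquality
open import Relation.Binary.Definitions using (tri<; tri≈; tri>)
open import Relation.Nullary using (¬_; Dec; yes; no; does; contradiction)
open import Relation.Nullary.Decidable using (_×-dec_; ¬?; decidable-stable)
open import Relation.Unary using (Pred; Decidable)
import Relation.Binary.Properties.DecTotalOrder as DTO
import Data.List.Sort as Sort
open import Algebra.Properties.CommutativeMonoid.Sum ℤP.+-0-commutativeMonoid
  using (sum; ∑-distrib-+; sum-cong-≗; sum-replicate-zero)
open import Algebra.Properties.Group (AbelianGroup.group ℤP.+-0-abelianGroup)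
  using () renaming (∙-cancelˡ to +-cancelˡ)

open Sort (DTO.≥-decTotalOrder ℤP.≤-decTotalOrder) using (sort-↭; sort-↗)

Band : ℤ → ℤ → Set
Band β v = β - 1ℤ ≤ v × v ≤ β

below-band : ∀ {β v} → v < β → v ≤ β - 1ℤ
below-band {β} {v} v<β = subst (v ≤_) (ℤP.+-comm -1ℤ β) (ℤP.i<j⇒i≤pred[j] v<β)

pred< : ∀ v → v - 1ℤ < v
pred< v = subst (v - 1ℤ <_) (ℤP.+-identityʳ v) (ℤP.+-monoʳ-< v ℤ.-<+)

-1+1 : ∀ v → (v - 1ℤ) + 1ℤ ≡ v
-1+1 v = trans (ℤP.+-assoc v -1ℤ 1ℤ) (ℤP.+-identityʳ v)

squeeze : ∀ {c d I J} → c ≤ I → d ≤ J → I + J ≤ c + d → c ≡ I × d ≡ J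
squeeze {c} {d} {I} {J} c≤I d≤J sum≤ =
  left c≤I d≤J sum≤ , left d≤J c≤I (subst₂ _≤_ (ℤP.+-comm I J) (ℤP.+-comm c d) sum≤)
  where
  left : ∀ {c d I J} → c ≤ I → d ≤ J → I + J ≤ c + d → c ≡ I
  left {c} {I = I} c≤I d≤J sum≤ with ℤP.<-cmp c I
  ... | tri< c<I _ _ = contradiction sum≤ (ℤP.<⇒≱ (ℤP.+-mono-<-≤ c<I d≤J))
  ... | tri≈ _ c≡I _ = c≡I
  ... | tri> _ _ I<c = contradiction c≤I (ℤP.<⇒≱ I<c)

≡∞⇒≥∞ : ∀ {v} q → v ≡∞ q → v ≥∞ q
≡∞⇒≥∞ (just a) refl = ℤP.≤-refl

≡∞⇒just : ∀ {v} q → v ≡∞ q → q ≡ just v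
≡∞⇒just (just a) refl = refl

≥∞-mono : ∀ {v w} q → v ≤ w → v ≥∞ q → w ≥∞ q
≥∞-mono nothing  _   _   = tt
≥∞-mono (just a) v≤w a≤v = ℤP.≤-trans a≤v v≤w

i<j⇒i-j<0 : ∀ {i j} → i < j → i - j < 0ℤ
i<j⇒i-j<0 {i} {j} i<j = subst (i - j <_) (ℤP.+-inverseʳ j) (ℤP.+-monoˡ-< (ℤ.- j) i<j)

-- Subset sums

restrict : ∀ {n} → Subset n → (Fin n → ℤ) → Fin n → ℤ
restrict Z x i = if lookup Z i then x i else 0ℤ

foldr-tabulate : ∀ {m n} (g : Fin m → ℤ) (f : Fin n → Fin m) →
  foldr (λ s acc → g s + acc) 0ℤ (tabulate f) ≡ sum (g ∘ f)
foldr-tabulate {n = zero}  g f = refl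
foldr-tabulate {n = suc n} g f = cong (_+_ (g (f zero))) (foldr-tabulate g (f ∘ suc))

tsum≡sum : ∀ {n} (x : Fin n → ℤ) Z → tsum x Z ≡ sum (restrict Z x)
tsum≡sum x Z = foldr-tabulate (restrict Z x) id

sum-mono-≤ : ∀ {n} {f g : Fin n → ℤ} → (∀ i → f i ≤ g i) → sum f ≤ sum g
sum-mono-≤ {zero}  f≤g = ℤP.≤-refl
sum-mono-≤ {suc n} f≤g = ℤP.+-mono-≤ (f≤g zero) (sum-mono-≤ (f≤g ∘ suc))

sum-mono-< : ∀ {n} {f g : Fin n → ℤ} → (∀ i → f i ≤ g i) → ∀ j → f j < g j → sum f < sum g
sum-mono-< f≤g zero    fj<gj = ℤP.+-mono-<-≤ fj<gj (sum-mono-≤ (f≤g ∘ suc))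
sum-mono-< f≤g (suc j) fj<gj = ℤP.+-mono-≤-< (f≤g zero) (sum-mono-< (f≤g ∘ suc) j fj<gj)

module _ {n : ℕ} {Z : Subset n} {i : Fin n} (x : Fin n → ℤ) where

  restrict-∈ : i ∈ Z → restrict Z x i ≡ x i
  restrict-∈ i∈Z rewrite VecP.[]=⇒lookup i∈Z = refl

  restrict-∉ : i ∉ Z → restrict Z x i ≡ 0ℤ
  restrict-∉ i∉Z with lookup Z i in eq
  ... | true  = contradiction (VecP.lookup⇒[]= i Z eq) i∉Z
  ... | false = refl

restrict-+ : ∀ {n} Z (f g : Fin n → ℤ) → restrict Z (λ i → f i + g i) ≗ λ i → restrict Z f i + restrict Z g i
restrict-+ Z f g i with lookup Z i
... | true  = refl
... | false = refl

tsum-+ : ∀ {n} (f g : Fin n → ℤ) Z → tsum (λ i → f i + g i) Z ≡ tsum f Z + tsum g Z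
tsum-+ f g Z = begin
  tsum (λ i → f i + g i) Z                    ≡⟨ tsum≡sum _ Z ⟩
  sum (restrict Z (λ i → f i + g i))          ≡⟨ sum-cong-≗ (restrict-+ Z f g) ⟩
  sum (λ i → restrict Z f i + restrict Z g i) ≡⟨ ∑-distrib-+ (restrict Z f) (restrict Z g) ⟩
  sum (restrict Z f) + sum (restrict Z g)     ≡⟨ cong₂ _+_ (tsum≡sum f Z) (tsum≡sum g Z) ⟨
  tsum f Z + tsum g Z                         ∎
  where open ≡-Reasoning

restrict-∩∪ : ∀ {n} (X Y : Subset n) f →
  (λ i → restrict (X ∩ Y) f i + restrict (X ∪ Y) f i) ≗ λ i → restrict X f i + restrict Y f i
restrict-∩∪ X Y f i
  rewrite VecP.lookup-zipWith _∧_ i X Y | VecP.lookup-zipWith _∨_ i X Y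
  with lookup X i | lookup Y i
... | true  | true  = refl
... | true  | false = trans (ℤP.+-identityˡ (f i)) (sym (ℤP.+-identityʳ (f i)))
... | false | true  = refl
... | false | false = refl

tsum-∩∪ : ∀ {n} (f : Fin n → ℤ) X Y → tsum f (X ∩ Y) + tsum f (X ∪ Y) ≡ tsum f X + tsum f Y
tsum-∩∪ f X Y = begin
  tsum f (X ∩ Y) + tsum f (X ∪ Y)                         ≡⟨ cong₂ _+_ (tsum≡sum f (X ∩ Y)) (tsum≡sum f (X ∪ Y)) ⟩
  sum (restrict (X ∩ Y) f) + sum (restrict (X ∪ Y) f)     ≡⟨ ∑-distrib-+ (restrict (X ∩ Y) f) _ ⟨
  sum (λ i → restrict (X ∩ Y) f i + restrict (X ∪ Y) f i) ≡⟨ sum-cong-≗ (restrict-∩∪ X Y f) ⟩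
  sum (λ i → restrict X f i + restrict Y f i)             ≡⟨ ∑-distrib-+ (restrict X f) _ ⟩
  sum (restrict X f) + sum (restrict Y f)                 ≡⟨ cong₂ _+_ (tsum≡sum f X) (tsum≡sum f Y) ⟨
  tsum f X + tsum f Y                                     ∎
  where open ≡-Reasoning

tsum-⊥ : ∀ {n} (f : Fin n → ℤ) → tsum f Sub.⊥ ≡ 0ℤ
tsum-⊥ {n} f = begin
  tsum f Sub.⊥               ≡⟨ tsum≡sum f Sub.⊥ ⟩
  sum (restrict Sub.⊥ f)     ≡⟨ sum-cong-≗ (λ i → restrict-∉ f (SubP.∉⊥ {x = i})) ⟩
  sum {n} (λ _ → 0ℤ)         ≡⟨ sum-replicate-zero n ⟩
  0ℤ                         ∎
  where open ≡-Reasoning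

tsum-const : ∀ {n} c (Z : Subset n) → tsum (λ _ → c) Z ≡ c * + ∣ Z ∣
tsum-const c Z = trans (tsum≡sum (λ _ → c) Z) (go Z)
  where
  go : ∀ {n} (Z : Subset n) → sum (restrict Z (λ _ → c)) ≡ c * + ∣ Z ∣
  go []          = sym (ℤP.*-zeroʳ c)
  go (true ∷ Z)  = trans (cong₂ _+_ (sym (ℤP.*-identityʳ c)) (go Z)) (sym (ℤP.*-distribˡ-+ c 1ℤ (+ ∣ Z ∣)))
  go (false ∷ Z) = trans (ℤP.+-identityˡ _) (go Z)

point : ∀ {n} → Fin n → ℤ → Fin n → ℤ
point zero    c zero    = c
point zero    c (suc i) = 0ℤ
point (suc s) c zero    = 0ℤ
point (suc s) c (suc i) = point s c i

point-same : ∀ {n} (s : Fin n) c → point s c s ≡ c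
point-same zero    c = refl
point-same (suc s) c = point-same s c

point-other : ∀ {n} {s i : Fin n} c → i ≢ s → point s c i ≡ 0ℤ
point-other {s = zero}  {zero}  c i≢s = contradiction refl i≢s
point-other {s = zero}  {suc i} c i≢s = refl
point-other {s = suc s} {zero}  c i≢s = refl
point-other {s = suc s} {suc i} c i≢s = point-other c (i≢s ∘ cong suc)

sum-point : ∀ {n} (s : Fin n) c → sum (point s c) ≡ c
sum-point {suc n} zero    c = trans (cong (_+_ c) (sum-replicate-zero n)) (ℤP.+-identityʳ c)
sum-point {suc n} (suc s) c = trans (ℤP.+-identityˡ _) (sum-point s c)

restrict-0 : ∀ {n} (Z : Subset n) f i → f i ≡ 0ℤ → restrict Z f i ≡ 0ℤ
restrict-0 Z f i fi≡0 with lookup Z i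
... | true  = fi≡0
... | false = refl

module _ {n : ℕ} {Z : Subset n} {s : Fin n} (c : ℤ) where

  tsum-point-∈ : s ∈ Z → tsum (point s c) Z ≡ c
  tsum-point-∈ s∈Z = trans (tsum≡sum (point s c) Z) (trans (sum-cong-≗ agree) (sum-point s c))
    where
    agree : restrict Z (point s c) ≗ point s c
    agree i with i FinP.≟ s
    ... | yes refl = restrict-∈ (point s c) s∈Z
    ... | no i≢s   = trans (restrict-0 Z (point s c) i (point-other c i≢s)) (sym (point-other c i≢s))

  tsum-point-∉ : s ∉ Z → tsum (point s c) Z ≡ 0ℤ
  tsum-point-∉ s∉Z = trans (tsum≡sum (point s c) Z) (trans (sum-cong-≗ vanish) (sum-replicate-zero n))
    where
    vanish : restrict Z (point s c) ≗ λ _ → 0ℤ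
    vanish i with i FinP.≟ s
    ... | yes refl = restrict-∉ (point s c) s∉Z
    ... | no i≢s   = restrict-0 Z (point s c) i (point-other c i≢s)

shift : ∀ {n} → (Fin n → ℤ) → Fin n → ℤ → Fin n → ℤ
shift y s c i = y i + point s c i

module _ {n : ℕ} (y : Fin n → ℤ) (s : Fin n) (c : ℤ) where

  shift-same : shift y s c s ≡ y s + c
  shift-same = cong (_+_ (y s)) (point-same s c)

  shift-other : ∀ {i} → i ≢ s → shift y s c i ≡ y i
  shift-other {i} i≢s = trans (cong (_+_ (y i)) (point-other c i≢s)) (ℤP.+-identityʳ (y i))

  tsum-shift-∈ : ∀ {Z} → s ∈ Z → tsum (shift y s c) Z ≡ tsum y Z + c
  tsum-shift-∈ {Z} s∈Z = trans (tsum-+ y (point s c) Z) (cong (_+_ (tsum y Z)) (tsum-point-∈ c s∈Z))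

  tsum-shift-∉ : ∀ {Z} → s ∉ Z → tsum (shift y s c) Z ≡ tsum y Z
  tsum-shift-∉ {Z} s∉Z =
    trans (tsum-+ y (point s c) Z) (trans (cong (_+_ (tsum y Z)) (tsum-point-∉ c s∉Z)) (ℤP.+-identityʳ _))

restrict-mono : ∀ {n} (Z : Subset n) {f g : Fin n → ℤ} → (∀ {i} → i ∈ Z → f i ≤ g i) → ∀ i →
  restrict Z f i ≤ restrict Z g i
restrict-mono Z {f} {g} f≤g i with i SubP.∈? Z
... | yes i∈Z rewrite restrict-∈ f i∈Z | restrict-∈ g i∈Z = f≤g i∈Z
... | no  i∉Z rewrite restrict-∉ f i∉Z | restrict-∉ g i∉Z = ℤP.≤-refl

tsum-mono-< : ∀ {n} {Z : Subset n} {f g : Fin n → ℤ} → (∀ {i} → i ∈ Z → f i ≤ g i) →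
  ∀ {s} → s ∈ Z → f s < g s → tsum f Z < tsum g Z
tsum-mono-< {Z = Z} {f} {g} f≤g {s} s∈Z fs<gs rewrite tsum≡sum f Z | tsum≡sum g Z =
  sum-mono-< (restrict-mono Z f≤g) s (subst₂ _<_ (sym (restrict-∈ f s∈Z)) (sym (restrict-∈ g s∈Z)) fs<gs)

tsum-⊂-< : ∀ {n} {X U : Subset n} {f : Fin n → ℤ} → X ⊆ U → (∀ {i} → i ∈ U → i ∉ X → f i ≤ 0ℤ) →
  ∀ {s} → s ∈ U → s ∉ X → f s < 0ℤ → tsum f U < tsum f X
tsum-⊂-< {X = X} {U} {f} X⊆U f≤0 {s} s∈U s∉X fs<0 rewrite tsum≡sum f U | tsum≡sum f X =
  sum-mono-< pointwise s (subst₂ _<_ (sym (restrict-∈ f s∈U)) (sym (restrict-∉ f s∉X)) fs<0)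
  where
  pointwise : ∀ i → restrict U f i ≤ restrict X f i
  pointwise i with i SubP.∈? X | i SubP.∈? U
  ... | yes i∈X | _ rewrite restrict-∈ f i∈X | restrict-∈ f (X⊆U i∈X) = ℤP.≤-refl
  ... | no  i∉X | yes i∈U rewrite restrict-∉ f i∉X | restrict-∈ f i∈U = f≤0 i∈U i∉X
  ... | no  i∉X | no  i∉U rewrite restrict-∉ f i∉X | restrict-∉ f i∉U = ℤP.≤-refl

tsum-minus-const : ∀ {n} (y : Fin n → ℤ) c Z → tsum y Z - c * + ∣ Z ∣ ≡ tsum (λ i → y i - c) Z
tsum-minus-const y c Z = begin
  tsum y Z - c * + ∣ Z ∣              ≡⟨ cong (_+_ (tsum y Z)) (ℤP.neg-distribˡ-* c (+ ∣ Z ∣)) ⟩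
  tsum y Z + - c * + ∣ Z ∣            ≡⟨ cong (_+_ (tsum y Z)) (tsum-const (- c) Z) ⟨
  tsum y Z + tsum (λ _ → - c) Z       ≡⟨ tsum-+ y (λ _ → - c) Z ⟨
  tsum (λ i → y i - c) Z              ∎
  where open ≡-Reasoning

card-∩∪ : ∀ {n} c (X Y : Subset n) → c * + ∣ X ∩ Y ∣ + c * + ∣ X ∪ Y ∣ ≡ c * + ∣ X ∣ + c * + ∣ Y ∣
card-∩∪ c X Y = begin
  c * + ∣ X ∩ Y ∣ + c * + ∣ X ∪ Y ∣               ≡⟨ cong₂ _+_ (tsum-const c (X ∩ Y)) (tsum-const c (X ∪ Y)) ⟨
  tsum (λ _ → c) (X ∩ Y) + tsum (λ _ → c) (X ∪ Y) ≡⟨ tsum-∩∪ (λ _ → c) X Y ⟩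
  tsum (λ _ → c) X + tsum (λ _ → c) Y             ≡⟨ cong₂ _+_ (tsum-const c X) (tsum-const c Y) ⟩
  c * + ∣ X ∣ + c * + ∣ Y ∣                       ∎
  where open ≡-Reasoning

-- Decreasing rearrangements

sumℤ : List ℤ → ℤ
sumℤ = foldr _+_ 0ℤ

sumℤ-↭ : ∀ {xs ys} → xs ↭ ys → sumℤ xs ≡ sumℤ ys
sumℤ-↭ p = PermₛP.foldr-commMonoid (setoid ℤ) ℤP.+-0-isCommutativeMonoid (↭⇒↭ₛ p)

Decreasing : List ℤ → Set
Decreasing = Linked (λ a b → b ≤ a)

module _ {n : ℕ} (U : Subset n) (x : Fin n → ℤ) where

  private
    inU? = λ (s : Fin n) → lookup U s Bool.≟ true
    members = filter inU? (allFin n)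
    values = map x members

  sum-decRearr : sumℤ (decRearr U x) ≡ tsum x U
  sum-decRearr = trans (sumℤ-↭ (sort-↭ values)) (go (allFin n))
    where
    go : ∀ l → sumℤ (map x (filter inU? l)) ≡ foldr (λ s acc → restrict U x s + acc) 0ℤ l
    go []      = refl
    go (s ∷ l) with lookup U s
    ... | true  = cong (_+_ (x s)) (go l)
    ... | false = trans (go l) (sym (ℤP.+-identityˡ _))

  length-decRearr : length (decRearr U x) ≡ length members
  length-decRearr = trans (PermP.↭-length (sort-↭ values)) (ListP.length-map x members)

  ∈-decRearr⁺ : ∀ {s} → s ∈ U → x s ∈ₗ decRearr U x
  ∈-decRearr⁺ {s} s∈U = PermP.∈-resp-↭ (↭-sym (sort-↭ values))
    (MemP.∈-map⁺ x (MemP.∈-filter⁺ inU? (MemP.∈-allFin s) (VecP.[]=⇒lookup s∈U)))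

  ∈-decRearr⁻ : ∀ {v} → v ∈ₗ decRearr U x → ∃[ s ] s ∈ U × v ≡ x s
  ∈-decRearr⁻ v∈ with MemP.∈-map⁻ x (PermP.∈-resp-↭ (sort-↭ values) v∈)
  ... | s , s∈ , v≡ = s , VecP.lookup⇒[]= s U (proj₂ (MemP.∈-filter⁻ inU? {xs = allFin n} s∈)) , v≡

  decRearr-decreasing : Decreasing (decRearr U x)
  decRearr-decreasing = sort-↗ values

length-decRearr-≡ : ∀ {n} (U : Subset n) x y → length (decRearr U x) ≡ length (decRearr U y)
length-decRearr-≡ U x y = trans (length-decRearr U x) (sym (length-decRearr U y))

DecLeq-antisym : ∀ as bs → DecLeq as bs → DecLeq bs as → as ≡ bs
DecLeq-antisym []       []       _                 _                 = refl
DecLeq-antisym (a ∷ as) (b ∷ bs) (inj₁ a<b)        (inj₁ b<a)        = contradiction a<b (ℤP.<-asym b<a)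
DecLeq-antisym (a ∷ as) (b ∷ bs) (inj₁ a<b)        (inj₂ (b≡a , _))  = contradiction a<b (ℤP.<-irrefl (sym b≡a))
DecLeq-antisym (a ∷ as) (b ∷ bs) (inj₂ (a≡b , _))  (inj₁ b<a)        = contradiction b<a (ℤP.<-irrefl (sym a≡b))
DecLeq-antisym (a ∷ as) (b ∷ bs) (inj₂ (a≡b , p))  (inj₂ (_ , q))    = cong₂ _∷_ a≡b (DecLeq-antisym as bs p q)

decreasing⇒≤head : ∀ {b bs} → Decreasing (b ∷ bs) → All (_≤ b) bs
decreasing⇒≤head [-]          = []
decreasing⇒≤head (b′≤b ∷ dec) = Linked⇒All (λ p q → ℤP.≤-trans q p) b′≤b dec

sumℤ-below≤sumℤ-above : ∀ {k} as bs → All (_≤ k) as → All (k ≤_) bs →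
  length as ≡ length bs → sumℤ as ≤ sumℤ bs
sumℤ-below≤sumℤ-above []       []       _          _          _   = ℤP.≤-refl
sumℤ-below≤sumℤ-above (a ∷ as) (b ∷ bs) (a≤k ∷ ps) (k≤b ∷ qs) len =
  ℤP.+-mono-≤ (ℤP.≤-trans a≤k k≤b) (sumℤ-below≤sumℤ-above as bs ps qs (ℕP.suc-injective len))

-- Were b < a at the first difference, b and every later entry of the decreasing list bs would lie
-- below the band, so bs would sum to less than as.
band⇒DecLeq : ∀ {β} as bs → All (Band β) as → Decreasing bs →
  length as ≡ length bs → sumℤ as ≡ sumℤ bs → DecLeq as bs
band⇒DecLeq []       []       _            _   _   _    = tt
band⇒DecLeq (a ∷ as) (b ∷ bs) (a∈β ∷ as∈β) dec len sum≡ with ℤP.<-cmp a b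
... | tri< a<b _ _ = inj₁ a<b
... | tri≈ _ a≡b _ = inj₂ (a≡b , band⇒DecLeq as bs as∈β (Linked.tail dec) (ℕP.suc-injective len)
                        (+-cancelˡ a (sumℤ as) (sumℤ bs) (trans sum≡ (cong (_+ sumℤ bs) (sym a≡b)))))
... | tri> _ _ b<a = contradiction (sym sum≡) (ℤP.<⇒≢ (ℤP.+-mono-<-≤ b<a
        (sumℤ-below≤sumℤ-above bs as (All.map (λ b′≤b → ℤP.≤-trans b′≤b b≤β-1) (decreasing⇒≤head dec))
          (All.map proj₁ as∈β) (sym (ℕP.suc-injective len)))))
  where
  b≤β-1 = below-band (ℤP.<-≤-trans b<a (proj₂ a∈β))

-- Families of subsets

allSubsets : ∀ n → List (Subset n)
allSubsets zero    = [] ∷ []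
allSubsets (suc n) = map (true ∷_) (allSubsets n) ++ map (false ∷_) (allSubsets n)

∈-allSubsets : ∀ {n} (Z : Subset n) → Z ∈ₗ allSubsets n
∈-allSubsets []          = here refl
∈-allSubsets (true ∷ Z)  = MemP.∈-++⁺ˡ (MemP.∈-map⁺ (true ∷_) (∈-allSubsets Z))
∈-allSubsets {suc n} (false ∷ Z) =
  MemP.∈-++⁺ʳ (map (true ∷_) (allSubsets n)) (MemP.∈-map⁺ (false ∷_) (∈-allSubsets Z))

∪-⊆ : ∀ {n} {X Y U : Subset n} → X ⊆ U → Y ⊆ U → X ∪ Y ⊆ U
∪-⊆ {X = X} {Y} X⊆U Y⊆U s∈X∪Y = [ X⊆U , Y⊆U ]′ (SubP.x∈p∪q⁻ X Y s∈X∪Y)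

x∈p─q⇒x∉q : ∀ {n} {x : Fin n} (p q : Subset n) → x ∈ p Sub.─ q → x ∉ q
x∈p─q⇒x∉q (true ∷ p) (false ∷ q) Vec.here        ()
x∈p─q⇒x∉q (_    ∷ p) (_     ∷ q) (Vec.there x∈) (Vec.there x∈q) = x∈p─q⇒x∉q p q x∈ x∈q

module _ {n : ℕ} {P : Pred (Fin n) 0ℓ} (P? : Decidable P) (X : Subset n) where

  covered-or-missed : (∀ {s} → P s → s ∈ X) ⊎ ∃[ s ] P s × s ∉ X
  covered-or-missed with FinP.any? (λ s → P? s ×-dec ¬? (s SubP.∈? X))
  ... | yes (s , Ps , s∉X) = inj₂ (s , Ps , s∉X)
  ... | no none = inj₁ λ {s} Ps → decidable-stable (s SubP.∈? X) (λ s∉X → none (s , Ps , s∉X))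

  avoided-or-hit : (∀ {s} → P s → s ∉ X) ⊎ ∃[ s ] P s × s ∈ X
  avoided-or-hit with FinP.any? (λ s → P? s ×-dec s SubP.∈? X)
  ... | yes (s , Ps , s∈X) = inj₂ (s , Ps , s∈X)
  ... | no none = inj₁ λ {s} Ps s∈X → none (s , Ps , s∈X)

module _ {n : ℕ} {𝓕 : Pred (Subset n) 0ℓ} (𝓕? : Decidable 𝓕) where

  private
    members = filter 𝓕? (allSubsets n)

    member-∈ : ∀ {Y} → 𝓕 Y → Y ∈ₗ members
    member-∈ {Y} 𝓕Y = MemP.∈-filter⁺ 𝓕? (∈-allSubsets Y) 𝓕Y

  largest : 𝓕 Sub.⊥ → (∀ {X Y} → 𝓕 X → 𝓕 Y → 𝓕 (X ∪ Y)) → ∃[ X ] 𝓕 X × (∀ {Y} → 𝓕 Y → Y ⊆ X)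
  largest 𝓕⊥ ∪-closed = ⋃ members , closed (AllP.all-filter 𝓕? (allSubsets n)) , λ 𝓕Y → ⊆⋃ (member-∈ 𝓕Y)
    where
    closed : ∀ {l} → All 𝓕 l → 𝓕 (⋃ l)
    closed []           = 𝓕⊥
    closed (𝓕X ∷ 𝓕l)   = ∪-closed 𝓕X (closed 𝓕l)
    ⊆⋃ : ∀ {Y l} → Y ∈ₗ l → Y ⊆ ⋃ l
    ⊆⋃ (here refl) = SubP.p⊆p∪q _
    ⊆⋃ {l = X ∷ l} (there Y∈l) = SubP.q⊆p∪q X (⋃ l) ∘′ ⊆⋃ Y∈l

  smallest : ∀ {A} → 𝓕 A → (∀ {X Y} → 𝓕 X → 𝓕 Y → 𝓕 (X ∩ Y)) → ∃[ X ] 𝓕 X × (∀ {Y} → 𝓕 Y → X ⊆ Y)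
  smallest {A} 𝓕A ∩-closed = ⋂A members , closed (AllP.all-filter 𝓕? (allSubsets n)) , λ 𝓕Y → ⋂A⊆ (member-∈ 𝓕Y)
    where
    ⋂A = foldr _∩_ A
    closed : ∀ {l} → All 𝓕 l → 𝓕 (⋂A l)
    closed []           = 𝓕A
    closed (𝓕X ∷ 𝓕l)   = ∩-closed 𝓕X (closed 𝓕l)
    ⋂A⊆ : ∀ {Y l} → Y ∈ₗ l → ⋂A l ⊆ Y
    ⋂A⊆ (here refl) = SubP.p∩q⊆p _ _
    ⋂A⊆ {l = X ∷ l} (there Y∈l) = ⋂A⊆ Y∈l ∘′ SubP.p∩q⊆q X (⋂A l)

module _ {n : ℕ} {P : Pred (Fin n) 0ℓ} (P? : Decidable P) where

  select : Subset n
  select = Vec.tabulate (λ i → does (P? i))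

  ∈-select⁺ : ∀ {s} → P s → s ∈ select
  ∈-select⁺ {s} Ps with P? s in eq
  ... | yes _  = VecP.lookup⇒[]= s select (trans (VecP.lookup∘tabulate (λ i → does (P? i)) s) (cong does eq))
  ... | no ¬Ps = contradiction Ps ¬Ps

  ∈-select⁻ : ∀ {s} → s ∈ select → P s
  ∈-select⁻ {s} s∈ with P? s | trans (sym (VecP.lookup∘tabulate (λ i → does (P? i)) s)) (VecP.[]=⇒lookup s∈)
  ... | yes Ps | _ = Ps

module _ {A : Set} (P Q : A → Set) (μ : A → ℤ) (μ≥0 : ∀ {x} → P x → 0ℤ ≤ μ x)
         (step : ∀ {x} → P x → Q x ⊎ ∃[ x′ ] P x′ × μ x′ < μ x) where

  descend : ∀ {x} → P x → ∃ Q
  descend Px = go (<-wellFounded _) Px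
    where
    go : ∀ {x} → Acc ℕ._<_ (ℤ.∣ μ x ∣) → P x → ∃ Q
    go {x} (acc smaller) Px with step Px
    ... | inj₁ Qx               = x , Qx
    ... | inj₂ (x′ , Px′ , dec) = go (smaller (ℤP.drop‿+<+ (subst₂ _<_ (abs Px′) (abs Px) dec))) Px′
      where
      abs : ∀ {x} → P x → μ x ≡ + ℤ.∣ μ x ∣
      abs Px = sym (ℤP.0≤i⇒+∣i∣≡i (μ≥0 Px))

-- Maximizers of supermodular set functions

module _ {n : ℕ} {h : SetFn n} where

  max-attained : ∀ {X a} → h X ≡ just a → ∃[ M ] IsMaximizer h M
  max-attained {X} {a} hX≡a =
    let M , v , hM , bound = go (allSubsets n) in M , v , hM , λ Y c → bound (∈-allSubsets Y) c
    where
    go : ∀ l → ∃[ M ] ∃[ v ] h M ≡ just v × (∀ {Y} → Y ∈ₗ l → ∀ c → h Y ≡ just c → c ≤ v)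
    go []      = X , a , hX≡a , λ ()
    go (Y ∷ l) with go l | h Y in hY
    ... | M , v , hM , bound | nothing = M , v , hM , λ where
            (here refl) c hY≡c → contradiction (trans (sym hY) hY≡c) λ ()
            (there Y∈l)        → bound Y∈l
    ... | M , v , hM , bound | just c with c ℤP.≤? v
    ...   | yes c≤v = M , v , hM , λ where
              (here refl) c′ hY≡c′ → subst (_≤ v) (MaybeP.just-injective (trans (sym hY) hY≡c′)) c≤v
              (there Y∈l)          → bound Y∈l
    ...   | no  c≰v = Y , c , hY , λ where
              (here refl) c′ hY≡c′ → ℤP.≤-reflexive (MaybeP.just-injective (trans (sym hY≡c′) hY))
              (there Y∈l) c′ hY≡c′ → ℤP.≤-trans (bound Y∈l c′ hY≡c′) (ℤP.<⇒≤ (ℤP.≰⇒> c≰v))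

  module _ (supermodular : Supermodular h) {v : ℤ} (bound : ∀ Y c → h Y ≡ just c → c ≤ v) where

    maximizers-∩ : ∀ {X Y} → h X ≡ just v → h Y ≡ just v → h (X ∩ Y) ≡ just v
    maximizers-∩ {X} {Y} hX hY with supermodular X Y v v hX hY
    ... | c , d , h∩≡c , h∪≡d , v+v≤c+d with squeeze (bound _ c h∩≡c) (bound _ d h∪≡d) v+v≤c+d
    ...   | refl , _ = h∩≡c

  intersection-of-maximizers : Supermodular h → ∀ {X a} → h X ≡ just a → ∀ {S₁} →
    (∀ s → (s ∈ S₁ → ∀ X → IsMaximizer h X → s ∈ X) × ((∀ X → IsMaximizer h X → s ∈ X) → s ∈ S₁)) →
    IsMaximizer h S₁
  intersection-of-maximizers supermodular hX≡a {S₁} peak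
    with max-attained hX≡a
  ... | M , v , hM , bound
    with smallest (λ X → MaybeP.≡-dec ℤP._≟_ (h X) (just v)) hM (maximizers-∩ supermodular bound)
  ... | R , hR , least = v , subst (λ Z → h Z ≡ just v) (SubP.⊆-antisym R⊆S₁ S₁⊆R) hR , bound
    where
    value-v : ∀ {X} → IsMaximizer h X → h X ≡ just v
    value-v (w , hX , boundX) = trans hX (cong just (ℤP.≤-antisym (bound _ w hX) (boundX _ v hM)))
    R⊆S₁ : R ⊆ S₁
    R⊆S₁ {s} s∈R = proj₂ (peak s) λ X maxX → least (value-v maxX) s∈R
    S₁⊆R : S₁ ⊆ R
    S₁⊆R {s} s∈S₁ = proj₁ (peak s) s∈S₁ R (v , hR , bound)

module H1 {n : ℕ} (p : SetFn n) (β : ℤ) where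

  private
    k = β - 1ℤ

  h1-just : ∀ {X a} → p X ≡ just a → h1 p β X ≡ just (a - k * + ∣ X ∣)
  h1-just pX≡a rewrite pX≡a = refl

  h1-just⁻ : ∀ {X v} → h1 p β X ≡ just v → ∃[ a ] p X ≡ just a × v ≡ a - k * + ∣ X ∣
  h1-just⁻ {X} h1X≡v with p X
  ... | just a = a , refl , sym (MaybeP.just-injective h1X≡v)

  h1-supermodular : Supermodular p → Supermodular (h1 p β)
  h1-supermodular supermodular X Y a′ b′ h1X h1Y
    with h1-just⁻ h1X | h1-just⁻ h1Y
  ... | a , pX , refl | b , pY , refl with supermodular X Y a b pX pY
  ...   | c , d , p∩ , p∪ , a+b≤c+d = _ , _ , h1-just p∩ , h1-just p∪ , (begin
    (a - K X) + (b - K Y)             ≡⟨ interchange a (K X) b (K Y) ⟩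
    (a + b) - (K X + K Y)             ≡⟨ cong (λ t → (a + b) - t) (card-∩∪ k X Y) ⟨
    (a + b) - (K (X ∩ Y) + K (X ∪ Y)) ≤⟨ ℤP.+-monoˡ-≤ _ a+b≤c+d ⟩
    (c + d) - (K (X ∩ Y) + K (X ∪ Y)) ≡⟨ interchange c (K (X ∩ Y)) d (K (X ∪ Y)) ⟨
    (c - K (X ∩ Y)) + (d - K (X ∪ Y)) ∎)
    where
    open ℤP.≤-Reasoning
    K : Subset n → ℤ
    K Z = k * + ∣ Z ∣
    interchange : ∀ a A b B → (a - A) + (b - B) ≡ (a + b) - (A + B)
    interchange = solve 4 (λ a A b B → (a :- A) :+ (b :- B) := (a :+ b) :- (A :+ B)) refl
      where open +-*-Solver

-- Integral bases of p on U

transfer : ∀ {n} → (Fin n → ℤ) → Fin n → Fin n → Fin n → ℤ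
transfer y a b = shift (shift y a -1ℤ) b 1ℤ

module _ {n : ℕ} (y : Fin n → ℤ) {a b : Fin n} (a≢b : a ≢ b) where

  transfer-from : transfer y a b a ≡ y a - 1ℤ
  transfer-from = trans (shift-other (shift y a -1ℤ) b 1ℤ a≢b) (shift-same y a -1ℤ)

  transfer-to : transfer y a b b ≡ y b + 1ℤ
  transfer-to = trans (shift-same (shift y a -1ℤ) b 1ℤ) (cong (_+ 1ℤ) (shift-other y a -1ℤ (a≢b ∘ sym)))

  transfer-other : ∀ {i} → i ≢ a → i ≢ b → transfer y a b i ≡ y i
  transfer-other i≢a i≢b = trans (shift-other (shift y a -1ℤ) b 1ℤ i≢b) (shift-other y a -1ℤ i≢a)

shift-down-≤ : ∀ {n} (y : Fin n → ℤ) s i → shift y s -1ℤ i ≤ y i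
shift-down-≤ y s i with i FinP.≟ s
... | yes refl = subst (_≤ y s) (sym (shift-same y s -1ℤ)) (ℤP.<⇒≤ (pred< (y s)))
... | no  i≢s  = ℤP.≤-reflexive (shift-other y s -1ℤ i≢s)

module _ {n : ℕ} (y : Fin n → ℤ) {a b : Fin n} {Z : Subset n} where

  tsum-transfer-∈∈ : a ∈ Z → b ∈ Z → tsum (transfer y a b) Z ≡ tsum y Z
  tsum-transfer-∈∈ a∈Z b∈Z = trans (tsum-shift-∈ (shift y a -1ℤ) b 1ℤ b∈Z)
    (trans (cong (_+ 1ℤ) (tsum-shift-∈ y a -1ℤ a∈Z)) (-1+1 (tsum y Z)))

  tsum-transfer-∈∉ : a ∈ Z → b ∉ Z → tsum (transfer y a b) Z ≡ tsum y Z - 1ℤ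
  tsum-transfer-∈∉ a∈Z b∉Z = trans (tsum-shift-∉ (shift y a -1ℤ) b 1ℤ b∉Z) (tsum-shift-∈ y a -1ℤ a∈Z)

  tsum-transfer-∉∈ : a ∉ Z → b ∈ Z → tsum (transfer y a b) Z ≡ tsum y Z + 1ℤ
  tsum-transfer-∉∈ a∉Z b∈Z =
    trans (tsum-shift-∈ (shift y a -1ℤ) b 1ℤ b∈Z) (cong (_+ 1ℤ) (tsum-shift-∉ y a -1ℤ a∉Z))

  tsum-transfer-∉∉ : a ∉ Z → b ∉ Z → tsum (transfer y a b) Z ≡ tsum y Z
  tsum-transfer-∉∉ a∉Z b∉Z = trans (tsum-shift-∉ (shift y a -1ℤ) b 1ℤ b∉Z) (tsum-shift-∉ y a -1ℤ a∉Z)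

module BasePolyhedron {n : ℕ} (p : SetFn n) (adm : IsAdmissible p) (U : Subset n) where
  open IsAdmissible adm

  Feasible : (Fin n → ℤ) → Set
  Feasible y = ∀ Z → Z ⊆ U → tsum y Z ≥∞ p Z

  Tight : (Fin n → ℤ) → Subset n → Set
  Tight y Z = p Z ≡ just (tsum y Z)

  tight? : ∀ y Z → Dec (Tight y Z)
  tight? y Z = MaybeP.≡-dec ℤP._≟_ (p Z) (just (tsum y Z))

  feasible⇒≤ : ∀ {y Z c} → Feasible y → Z ⊆ U → p Z ≡ just c → c ≤ tsum y Z
  feasible⇒≤ {y} {Z} feas Z⊆U pZ≡c = subst (tsum y Z ≥∞_) pZ≡c (feas Z Z⊆U)

  InB'⇒feasible : ∀ {y} → InB' U p y → Feasible y
  InB'⇒feasible (sum≡ , above) Z Z⊆U with covered-or-missed (SubP._∈? U) Z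
  ... | inj₂ (s , s∈U , s∉Z) = above Z (Z⊆U , s , s∈U , s∉Z)
  ... | inj₁ U⊆Z rewrite SubP.⊆-antisym Z⊆U U⊆Z = ≡∞⇒≥∞ (p U) sum≡

  InB'⇒tight : ∀ {y} → InB' U p y → Tight y U
  InB'⇒tight (sum≡ , _) = ≡∞⇒just (p U) sum≡

  feasible∧tight⇒InB' : ∀ {y} → Feasible y → Tight y U → InB' U p y
  feasible∧tight⇒InB' {y} feas tight = subst (tsum y U ≡∞_) (sym tight) refl , λ Z Z⊂U → feas Z (proj₁ Z⊂U)

  tight-⊥ : ∀ y → Tight y Sub.⊥
  tight-⊥ y = trans empty-zero (cong just (sym (tsum-⊥ y)))

  TightPart : (Fin n → ℤ) → Subset n → Set
  TightPart y Z = Z ⊆ U × Tight y Z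

  tightPart? : ∀ y Z → Dec (TightPart y Z)
  tightPart? y Z = Z SubP.⊆? U ×-dec tight? y Z

  -- Supermodularity of p against modularity of tsum leaves no room for slack on X ∩ Y and X ∪ Y.
  tight-∩∪ : ∀ {y X Y} → Feasible y → TightPart y X → TightPart y Y → Tight y (X ∩ Y) × Tight y (X ∪ Y)
  tight-∩∪ {y} {X} {Y} feas (X⊆U , tX) (Y⊆U , tY) with supermodular X Y _ _ tX tY
  ... | c , d , p∩≡c , p∪≡d , sum≤
    with squeeze (feasible⇒≤ feas (X⊆U ∘′ SubP.p∩q⊆p X Y) p∩≡c) (feasible⇒≤ feas (∪-⊆ X⊆U Y⊆U) p∪≡d)
                 (subst (_≤ c + d) (sym (tsum-∩∪ y X Y)) sum≤)
  ... | refl , refl = p∩≡c , p∪≡d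

  tightPart-∩ : ∀ {y X Y} → Feasible y → TightPart y X → TightPart y Y → TightPart y (X ∩ Y)
  tightPart-∩ {X = X} {Y} feas tX tY = proj₁ tX ∘′ SubP.p∩q⊆p X Y , proj₁ (tight-∩∪ feas tX tY)

  tightPart-∪ : ∀ {y X Y} → Feasible y → TightPart y X → TightPart y Y → TightPart y (X ∪ Y)
  tightPart-∪ feas tX tY = ∪-⊆ (proj₁ tX) (proj₁ tY) , proj₂ (tight-∩∪ feas tX tY)

  slack : ∀ {y Z} → Feasible y → Z ⊆ U → ¬ Tight y Z → (tsum y Z - 1ℤ) ≥∞ p Z
  slack {y} {Z} feas Z⊆U loose with p Z in pZ
  ... | nothing = tt
  ... | just c  = below-band (ℤP.≤∧≢⇒< (feasible⇒≤ feas Z⊆U pZ) (λ c≡ → loose (cong just c≡)))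

  lower-feasible : ∀ {y s} → Feasible y → (∀ Z → Z ⊆ U → s ∈ Z → ¬ Tight y Z) → Feasible (shift y s -1ℤ)
  lower-feasible {y} {s} feas loose Z Z⊆U with s SubP.∈? Z
  ... | yes s∈Z rewrite tsum-shift-∈ y s -1ℤ s∈Z = slack feas Z⊆U (loose Z Z⊆U s∈Z)
  ... | no  s∉Z rewrite tsum-shift-∉ y s -1ℤ s∉Z = feas Z Z⊆U

  transfer-feasible : ∀ {y a b} → Feasible y → (∀ Z → Z ⊆ U → a ∈ Z → b ∉ Z → ¬ Tight y Z) →
    Feasible (transfer y a b)
  transfer-feasible {y} {a} {b} feas loose Z Z⊆U with a SubP.∈? Z | b SubP.∈? Z
  ... | yes a∈Z | yes b∈Z rewrite tsum-transfer-∈∈ y a∈Z b∈Z = feas Z Z⊆U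
  ... | yes a∈Z | no  b∉Z rewrite tsum-transfer-∈∉ y a∈Z b∉Z = slack feas Z⊆U (loose Z Z⊆U a∈Z b∉Z)
  ... | no  a∉Z | yes b∈Z rewrite tsum-transfer-∉∈ y a∉Z b∈Z = ≥∞-mono (p Z) (ℤP.i≤i+j (tsum y Z) 1ℤ) (feas Z Z⊆U)
  ... | no  a∉Z | no  b∉Z rewrite tsum-transfer-∉∉ y a∉Z b∉Z = feas Z Z⊆U

  transfer-tight : ∀ {y a b} → a ∈ U → b ∈ U → Tight y U → Tight (transfer y a b) U
  transfer-tight {y} a∈U b∈U tight rewrite tsum-transfer-∈∈ y a∈U b∈U = tight

  untight-element : ∀ {y} → Feasible y → ¬ Tight y U → ∃[ s ] s ∈ U × (∀ Z → Z ⊆ U → s ∈ Z → ¬ Tight y Z)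
  untight-element {y} feas loose with largest (tightPart? y) (SubP.⊥⊆ , tight-⊥ y) (tightPart-∪ feas)
  ... | X , (X⊆U , tX) , maximal with covered-or-missed (SubP._∈? U) X
  ...   | inj₁ U⊆X = contradiction (subst (Tight y) (SubP.⊆-antisym X⊆U U⊆X) tX) loose
  ...   | inj₂ (s , s∈U , s∉X) = s , s∈U , λ Z Z⊆U s∈Z tZ → s∉X (maximal (Z⊆U , tZ) s∈Z)

  dominated-base : ∀ {a z} → p U ≡ just a → Feasible z → ∃[ y ] InB' U p y × (∀ s → y s ≤ z s)
  dominated-base {a} {z} pU≡a feas-z = descend P Q μ μ≥0 step (feas-z , λ _ → ℤP.≤-refl)
    where
    P Q : (Fin n → ℤ) → Set
    P y = Feasible y × (∀ s → y s ≤ z s)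
    Q y = InB' U p y × (∀ s → y s ≤ z s)
    μ : (Fin n → ℤ) → ℤ
    μ y = tsum y U - a
    μ≥0 : ∀ {y} → P y → 0ℤ ≤ μ y
    μ≥0 (feas , _) = ℤP.i≤j⇒0≤j-i (feasible⇒≤ feas SubP.⊆-refl pU≡a)
    step : ∀ {y} → P y → Q y ⊎ ∃[ y′ ] P y′ × μ y′ < μ y
    step {y} (feas , y≤z) with tight? y U
    ... | yes tight = inj₁ (feasible∧tight⇒InB' feas tight , y≤z)
    ... | no loose with untight-element feas loose
    ...   | s , s∈U , untight = inj₂ (shift y s -1ℤ , (lower-feasible feas untight , y′≤z) , μ↓)
      where
      y′≤z : ∀ i → shift y s -1ℤ i ≤ z i
      y′≤z i = ℤP.≤-trans (shift-down-≤ y s i) (y≤z i)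
      μ↓ : μ (shift y s -1ℤ) < μ y
      μ↓ rewrite tsum-shift-∈ y s -1ℤ s∈U = ℤP.+-monoˡ-< (- a) (pred< (tsum y U))

  base-sum : ∀ {y w} → InB' U p y → InB' U p w → tsum y U ≡ tsum w U
  base-sum yB wB = MaybeP.just-injective (trans (sym (InB'⇒tight yB)) (InB'⇒tight wB))

  module _ (β : ℤ) where

    InBand : (Fin n → ℤ) → Set
    InBand y = ∀ {s} → s ∈ U → Band β (y s)

    band⇒decMin : ∀ {y} → InB' U p y → InBand y → IsDecMin U p y
    band⇒decMin {y} yB y∈band = yB , λ w wB →
      band⇒DecLeq (decRearr U y) (decRearr U w) entries-in-band (decRearr-decreasing U w)
        (length-decRearr-≡ U y w) (begin
          sumℤ (decRearr U y) ≡⟨ sum-decRearr U y ⟩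
          tsum y U            ≡⟨ base-sum yB wB ⟩
          tsum w U            ≡⟨ sum-decRearr U w ⟨
          sumℤ (decRearr U w) ∎)
      where
      open ≡-Reasoning
      entries-in-band : All (Band β) (decRearr U y)
      entries-in-band = All.tabulate λ v∈ → let s , s∈U , v≡ys = ∈-decRearr⁻ U y v∈ in
        subst (Band β) (sym v≡ys) (y∈band s∈U)

    decMin⇒band : ∀ {y m} → InB' U p y → InBand y → IsDecMin U p m → InBand m
    decMin⇒band {y} {m} yB y∈band (mB , m-min) {s} s∈U =
      let t , t∈U , ms≡yt = ∈-decRearr⁻ U y (subst (m s ∈ₗ_) same (∈-decRearr⁺ U m s∈U))
      in subst (Band β) (sym ms≡yt) (y∈band t∈U)
      where
      same : decRearr U m ≡ decRearr U y
      same = DecLeq-antisym _ _ (m-min y yB) (proj₂ (band⇒decMin yB y∈band) m mB)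

-- Bases in the band [β - 1, β]

module Bands {n : ℕ} (p : SetFn n) (adm : IsAdmissible p) (β : ℤ) (U : Subset n) where
  open BasePolyhedron p adm U
  open H1 p β

  private
    k = β - 1ℤ

  -- The largest tight set avoiding s would otherwise contain every β-entry of U and beat U in h1.
  improve-step : IsMaximizer (h1 p β) U → ∀ {y s} → Feasible y → Tight y U → (∀ {i} → i ∈ U → y i ≤ β) →
    s ∈ U → y s < k → ∃[ t ] (t ∈ U × y t ≡ β) × (∀ Z → Z ⊆ U → t ∈ Z → s ∉ Z → ¬ Tight y Z)
  improve-step (v , h1U , bound) {y} {s} feas tight y≤β s∈U ys<k
    with largest (λ Z → tightPart? y Z ×-dec ¬? (s SubP.∈? Z)) ((SubP.⊥⊆ , tight-⊥ y) , SubP.∉⊥) ∪-closed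
    where
    ∪-closed : ∀ {X Y} → TightPart y X × s ∉ X → TightPart y Y × s ∉ Y → TightPart y (X ∪ Y) × s ∉ X ∪ Y
    ∪-closed {X} {Y} (tX , s∉X) (tY , s∉Y) =
      tightPart-∪ feas tX tY , λ s∈X∪Y → [ s∉X , s∉Y ]′ (SubP.x∈p∪q⁻ X Y s∈X∪Y)
  ... | X , ((X⊆U , tX) , s∉X) , maximal
    with covered-or-missed (λ t → t SubP.∈? U ×-dec y t ℤP.≟ β) X
  ... | inj₂ (t , t-top , t∉X) = t , t-top , λ Z Z⊆U t∈Z s∉Z tZ → t∉X (maximal ((Z⊆U , tZ) , s∉Z) t∈Z)
  ... | inj₁ covered = contradiction (bound X _ (h1-just tX)) (ℤP.<⇒≱ (begin-strict
    v                          ≡⟨ MaybeP.just-injective (trans (sym h1U) (h1-just tight)) ⟩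
    tsum y U - k * + ∣ U ∣     ≡⟨ tsum-minus-const y k U ⟩
    tsum (λ i → y i - k) U     <⟨ tsum-⊂-< X⊆U off-top s∈U s∉X (i<j⇒i-j<0 ys<k) ⟩
    tsum (λ i → y i - k) X     ≡⟨ tsum-minus-const y k X ⟨
    tsum y X - k * + ∣ X ∣     ∎))
    where
    open ℤP.≤-Reasoning
    off-top : ∀ {i} → i ∈ U → i ∉ X → y i - k ≤ 0ℤ
    off-top i∈U i∉X = ℤP.i≤j⇒i-j≤0 (below-band (ℤP.≤∧≢⇒< (y≤β i∈U) λ yi≡β → i∉X (covered (i∈U , yi≡β))))

  top? : ∀ (y : Fin n → ℤ) i → Dec (i ∈ U × y i ≡ β)
  top? y i = i SubP.∈? U ×-dec y i ℤP.≟ β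

  top : (Fin n → ℤ) → Subset n
  top y = select (top? y)

  top-IsL1 : ∀ y → IsL1 U β y (top y)
  top-IsL1 y i = ∈-select⁻ (top? y) , ∈-select⁺ (top? y)

  transfer-down-top : ∀ {y t s} → (∀ {i} → i ∈ U → y i ≤ β) → t ∈ U → y t ≡ β → y s < k →
    (∀ {i} → i ∈ U → transfer y t s i ≤ β) × top (transfer y t s) ⊂ top y
  transfer-down-top {y} {t} {s} y≤β t∈U yt≡β ys<k = y′≤β , top′⊆top , t , proj₂ (top-IsL1 y t) (t∈U , yt≡β) ,
    λ t∈top′ → ℤP.<⇒≢ (moved<β (inj₁ refl)) (proj₂ (proj₁ (top-IsL1 y′ t) t∈top′))
    where
    t≢s : t ≢ s
    t≢s refl = ℤP.<-asym ys<k (subst (k <_) (sym yt≡β) (pred< β))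
    y′ = transfer y t s
    moved<β : ∀ {i} → i ≡ t ⊎ i ≡ s → y′ i < β
    moved<β (inj₁ refl) = subst (_< β) (sym (trans (transfer-from y t≢s) (cong (_- 1ℤ) yt≡β))) (pred< β)
    moved<β (inj₂ refl) = subst (_< β) (sym (transfer-to y t≢s))
      (ℤP.≤-<-trans (subst (_≤ k) (ℤP.+-comm 1ℤ (y s)) (ℤP.i<j⇒suc[i]≤j ys<k)) (pred< β))
    y′≤β : ∀ {i} → i ∈ U → y′ i ≤ β
    y′≤β {i} i∈U with i FinP.≟ t | i FinP.≟ s
    ... | yes i≡t | _       = ℤP.<⇒≤ (moved<β (inj₁ i≡t))
    ... | no  _   | yes i≡s = ℤP.<⇒≤ (moved<β (inj₂ i≡s))
    ... | no  i≢t | no  i≢s = subst (_≤ β) (sym (transfer-other y t≢s i≢t i≢s)) (y≤β i∈U)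
    top′⊆top : top y′ ⊆ top y
    top′⊆top {i} i∈top′ with proj₁ (top-IsL1 y′ i) i∈top′
    ... | i∈U , y′i≡β with i FinP.≟ t | i FinP.≟ s
    ...   | yes i≡t | _       = contradiction y′i≡β (ℤP.<⇒≢ (moved<β (inj₁ i≡t)))
    ...   | no  _   | yes i≡s = contradiction y′i≡β (ℤP.<⇒≢ (moved<β (inj₂ i≡s)))
    ...   | no  i≢t | no  i≢s = proj₂ (top-IsL1 y i) (i∈U , trans (sym (transfer-other y t≢s i≢t i≢s)) y′i≡β)

  base≤β⇒band-base : IsMaximizer (h1 p β) U → ∀ {z} → InB' U p z → (∀ {i} → i ∈ U → z i ≤ β) →
    ∃[ y ] InB' U p y × InBand β y
  base≤β⇒band-base maxU zB z≤β = descend P Q (λ y → + ∣ top y ∣) (λ _ → ℤ.+≤+ ℕ.z≤n) step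
    (InB'⇒feasible zB , InB'⇒tight zB , z≤β)
    where
    P Q : (Fin n → ℤ) → Set
    P y = Feasible y × Tight y U × (∀ {i} → i ∈ U → y i ≤ β)
    Q y = InB' U p y × InBand β y
    step : ∀ {y} → P y → Q y ⊎ ∃[ y′ ] P y′ × + ∣ top y′ ∣ < + ∣ top y ∣
    step {y} (feas , tight , y≤β) with FinP.any? (λ s → s SubP.∈? U ×-dec y s ℤP.<? k)
    ... | no none = inj₁ (feasible∧tight⇒InB' feas tight ,
                          λ {s} s∈U → ℤP.≮⇒≥ (λ ys<k → none (s , s∈U , ys<k)) , y≤β s∈U)
    ... | yes (s , s∈U , ys<k) with improve-step maxU feas tight y≤β s∈U ys<k
    ...   | t , (t∈U , yt≡β) , untight with transfer-down-top y≤β t∈U yt≡β ys<k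
    ...     | y′≤β , shrinks = inj₂ (transfer y t s ,
                (transfer-feasible feas untight , transfer-tight t∈U s∈U tight , y′≤β) ,
                ℤ.+<+ (SubP.p⊂q⇒∣p∣<∣q∣ shrinks))

  feasible≤β⇒band-base : IsMaximizer (h1 p β) U → ∀ {z} → Feasible z → (∀ i → z i ≤ β) →
    ∃[ y ] InB' U p y × InBand β y
  feasible≤β⇒band-base maxU@(_ , h1U , _) z-feasible z≤β
    with dominated-base (proj₁ (proj₂ (h1-just⁻ h1U))) z-feasible
  ... | y , yB , y≤z = base≤β⇒band-base maxU yB λ {i} _ → ℤP.≤-trans (y≤z i) (z≤β i)

  -- The smallest tight set of m containing x would otherwise carry strictly less m′-weight than m-weight.
  exchange-step : ∀ {m m′ x} → Feasible m → Tight m U → InBand β m → Feasible m′ → InBand β m′ →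
    x ∈ U → m x ≡ β → m′ x ≢ β →
    ∃[ t ] (t ∈ U × m t ≢ β × m′ t ≡ β) × (∀ Z → Z ⊆ U → x ∈ Z → t ∉ Z → ¬ Tight m Z)
  exchange-step {m} {m′} {x} feas tight m∈band feas′ m′∈band x∈U mx≡β m′x≢β
    with smallest (λ Z → tightPart? m Z ×-dec x SubP.∈? Z) ((SubP.⊆-refl , tight) , x∈U) ∩-closed
    where
    ∩-closed : ∀ {X Y} → TightPart m X × x ∈ X → TightPart m Y × x ∈ Y → TightPart m (X ∩ Y) × x ∈ X ∩ Y
    ∩-closed (tX , x∈X) (tY , x∈Y) = tightPart-∩ feas tX tY , SubP.x∈p∩q⁺ (x∈X , x∈Y)
  ... | T , ((T⊆U , tT) , x∈T) , least
    with avoided-or-hit (λ t → t SubP.∈? U ×-dec ¬? (m t ℤP.≟ β) ×-dec m′ t ℤP.≟ β) T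
  ... | inj₂ (t , new , t∈T) = t , new , λ Z Z⊆U x∈Z t∉Z tZ → t∉Z (least ((Z⊆U , tZ) , x∈Z) t∈T)
  ... | inj₁ avoided = contradiction (feasible⇒≤ feas′ T⊆U tT)
          (ℤP.<⇒≱ (tsum-mono-< m′≤m x∈T (subst (m′ x <_) (sym mx≡β) (ℤP.≤∧≢⇒< (proj₂ (m′∈band x∈U)) m′x≢β))))
    where
    m′≤m : ∀ {i} → i ∈ T → m′ i ≤ m i
    m′≤m {i} i∈T with T⊆U i∈T | m i ℤP.≟ β
    ... | i∈U | yes mi≡β = subst (m′ i ≤_) (sym mi≡β) (proj₂ (m′∈band i∈U))
    ... | i∈U | no  mi≢β = ℤP.≤-trans
          (below-band (ℤP.≤∧≢⇒< (proj₂ (m′∈band i∈U)) λ m′i≡β → avoided (i∈U , mi≢β , m′i≡β) i∈T))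
          (proj₁ (m∈band i∈U))

  IsL1⇒⊆ : ∀ {m L} → IsL1 U β m L → L ⊆ U
  IsL1⇒⊆ L1 {s} s∈L = proj₁ (proj₁ (L1 s) s∈L)

  IsL1-transfer : ∀ {m B x t} → IsL1 U β m B → x ≢ t → t ∈ U → t ∉ B →
    transfer m x t x ≢ β → transfer m x t t ≡ β → IsL1 U β (transfer m x t) ((B Sub.- x) ∪ ⁅ t ⁆)
  IsL1-transfer {m} {B} {x} {t} L1 x≢t t∈U t∉B m″x≢β m″t≡β u = into , onto
    where
    m″ = transfer m x t
    into : u ∈ (B Sub.- x) ∪ ⁅ t ⁆ → u ∈ U × m″ u ≡ β
    into u∈ with SubP.x∈p∪q⁻ (B Sub.- x) ⁅ t ⁆ u∈
    ... | inj₂ u∈⁅t⁆ rewrite SubP.x∈⁅y⁆⇒x≡y t u∈⁅t⁆ = t∈U , m″t≡β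
    ... | inj₁ u∈B-x with u FinP.≟ t
    ...   | yes refl = contradiction (SubP.p─q⊆p B ⁅ x ⁆ u∈B-x) t∉B
    ...   | no  u≢t =
      let u∈U , mu≡β = proj₁ (L1 u) (SubP.p─q⊆p B ⁅ x ⁆ u∈B-x)
          u≢x = SubP.x∉⁅y⁆⇒x≢y (x∈p─q⇒x∉q B ⁅ x ⁆ u∈B-x)
      in u∈U , trans (transfer-other m x≢t u≢x u≢t) mu≡β
    onto : u ∈ U × m″ u ≡ β → u ∈ (B Sub.- x) ∪ ⁅ t ⁆
    onto (u∈U , m″u≡β) with u FinP.≟ x | u FinP.≟ t
    ... | yes refl | _        = contradiction m″u≡β m″x≢β
    ... | no  _    | yes refl = SubP.x∈p∪q⁺ (inj₂ (SubP.x∈⁅x⁆ t))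
    ... | no  u≢x  | no  u≢t  = SubP.x∈p∪q⁺ (inj₁ (SubP.x∈p∧x≢y⇒x∈p-y
          (proj₂ (L1 u) (u∈U , trans (sym (transfer-other m x≢t u≢x u≢t)) m″u≡β)) u≢x))

  exchanged-base : ∀ {m B x t} → InB' U p m → InBand β m → IsL1 U β m B → x ∈ B → t ∈ U → m t ≢ β →
    (∀ Z → Z ⊆ U → x ∈ Z → t ∉ Z → ¬ Tight m Z) → Bases1 p β U ((B Sub.- x) ∪ ⁅ t ⁆)
  exchanged-base {m} {B} {x} {t} mB m∈band L1 x∈B t∈U mt≢β untight =
    IsL1⇒⊆ L1″ , m″ , band⇒decMin β m″B m″∈band , L1″
    where
    x∈U = proj₁ (proj₁ (L1 x) x∈B)
    mx≡β = proj₂ (proj₁ (L1 x) x∈B)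
    x≢t : x ≢ t
    x≢t refl = mt≢β mx≡β
    m″ = transfer m x t
    m″B : InB' U p m″
    m″B = feasible∧tight⇒InB' (transfer-feasible (InB'⇒feasible mB) untight)
                              (transfer-tight x∈U t∈U (InB'⇒tight mB))
    mt≡k : m t ≡ k
    mt≡k = ℤP.≤-antisym (below-band (ℤP.≤∧≢⇒< (proj₂ (m∈band t∈U)) mt≢β)) (proj₁ (m∈band t∈U))
    m″x≡k : m″ x ≡ k
    m″x≡k = trans (transfer-from m x≢t) (cong (_- 1ℤ) mx≡β)
    m″t≡β : m″ t ≡ β
    m″t≡β = trans (transfer-to m x≢t) (trans (cong (_+ 1ℤ) mt≡k) (-1+1 β))
    m″∈band : InBand β m″
    m″∈band {u} u∈U with u FinP.≟ x | u FinP.≟ t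
    ... | yes refl | _        = subst (Band β) (sym m″x≡k) (ℤP.≤-refl , ℤP.<⇒≤ (pred< β))
    ... | no  _    | yes refl = subst (Band β) (sym m″t≡β) (ℤP.<⇒≤ (pred< β) , ℤP.≤-refl)
    ... | no  u≢x  | no  u≢t  = subst (Band β) (sym (transfer-other m x≢t u≢x u≢t)) (m∈band u∈U)
    L1″ : IsL1 U β m″ ((B Sub.- x) ∪ ⁅ t ⁆)
    L1″ = IsL1-transfer L1 x≢t t∈U (λ t∈B → mt≢β (proj₂ (proj₁ (L1 t) t∈B)))
            (λ m″x≡β → ℤP.<⇒≢ (pred< β) (trans (sym m″x≡k) m″x≡β)) m″t≡β

  module _ {y : Fin n → ℤ} (yB : InB' U p y) (y∈band : InBand β y) where

    bases-exchange : ∀ B B′ → Bases1 p β U B → Bases1 p β U B′ → ∀ x → x ∈ B → x ∉ B′ →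
      ∃[ t ] (t ∈ B′ × t ∉ B × Bases1 p β U ((B Sub.- x) ∪ ⁅ t ⁆))
    bases-exchange B B′ (_ , m , m-min , L1) (_ , m′ , m′-min , L1′) x x∈B x∉B′
      with exchange-step (InB'⇒feasible (proj₁ m-min)) (InB'⇒tight (proj₁ m-min)) m∈band
             (InB'⇒feasible (proj₁ m′-min)) (decMin⇒band β yB y∈band m′-min)
             x∈U mx≡β (λ m′x≡β → x∉B′ (proj₂ (L1′ x) (x∈U , m′x≡β)))
      where
      x∈U = proj₁ (proj₁ (L1 x) x∈B)
      mx≡β = proj₂ (proj₁ (L1 x) x∈B)
      m∈band = decMin⇒band β yB y∈band m-min
    ... | t , (t∈U , mt≢β , m′t≡β) , untight =
      t , proj₂ (L1′ t) (t∈U , m′t≡β) , (λ t∈B → mt≢β (proj₂ (proj₁ (L1 t) t∈B))) ,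
      exchanged-base (proj₁ m-min) (decMin⇒band β yB y∈band m-min) L1 x∈B t∈U mt≢β untight

    bases-nonempty : ∃[ B ] Bases1 p β U B
    bases-nonempty = top y , IsL1⇒⊆ (top-IsL1 y) , y , band⇒decMin β yB y∈band , top-IsL1 y

theorem4p11 : (n : ℕ) → n ≥ 1 → (p : SetFn n) → IsAdmissible p →
    (β₁ : ℤ) → IsBeta1 p β₁ → (S₁ : Subset n) → IsPeakSet p β₁ S₁ →
    IsMatroidBases S₁ (Bases1 p β₁ S₁)
theorem4p11 n _ p adm β₁ ((z , zB , _ , z≤β₁) , _) S₁ peak =
  let y , yB , y∈band = feasible≤β⇒band-base S₁-max z-feasible z≤β₁
  in (λ _ → proj₁) , bases-nonempty yB y∈band , bases-exchange yB y∈band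
  where
  open IsAdmissible adm
  open H1 p β₁
  open BasePolyhedron p adm S₁
  open Bands p adm β₁ S₁
  S₁-max : IsMaximizer (h1 p β₁) S₁
  S₁-max = intersection-of-maximizers (h1-supermodular supermodular) (h1-just empty-zero) peak
  z-feasible : Feasible z
  z-feasible Z _ = BasePolyhedron.InB'⇒feasible p adm Sub.⊤ zB Z (λ _ → SubP.∈⊤)
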